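{- Let $(\mathcal R,\exp)$ be an exponential field which is o-minimal (as a structure in the language $(+,\cdot,0,1,\leqslant,\exp)$). Let $\mathcal M\subseteq\mathcal R$ be a discretely ordered ring and $x^y\colon M^+\times M^+\to M^+$ a function such that $(\mathcal M,x^y)$ is an $x^y$-integer part of $(\mathcal R,\exp)$. Then $(\mathcal M^+,x^y)$, with $S(x)$ interpreted as $x+1$, is a model of $\mathsf{IOpen}(x^y)$.
   Context: An exponential field is an ordered field $\mathcal F$ with a map $\exp\colon F\to F^{>0}$ that is an order-preserving isomorphism from $(F,+)$ onto $(F^{>0},\cdot)$; $\log$ denotes its inverse. A structure with a dense linear order is o-minimal if every definable (with parameters) subset of its domain is a finite union of intervals and points. A discretely ordered ring is an ordered (commutative unital) ring in which $1$ is the least positive element; $M^+=\{m\in M:m\geqslant0\}$. If $\mathcal M\subseteq\mathcal R$ with $\mathcal M$ discretely ordered, $\mathcal M$ is an integer part of $\mathcal R$ if for each $r\in R$ there is $m\in M$ with $m\leqslant r<m+1$. $(\mathcal M,x^y)$ is an $x^y$-integer part of $(\mathcal R,\exp)$ if $\mathcal M$ is an integer part of $\mathcal R$ and (1) $n^m=\exp(m\cdot\log n)$ for all $n,m\in M^+$ with $n>0$, (2) $0^0=1$, (3) $0^m=0$ for all $m\in M^{>0}$. The theory $\mathsf{IOpen}(x^y)$ in the language $(0,S,+,\cdot,\leqslant,x^y)$ consists of: (Q1) $Sx\neq 0$; (Q2) $Sx=Sy\to x=y$; (Q3) $x\neq0\to\exists y\,(x=Sy)$; (Q4) $x+0=x$;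 (Q5) $x+Sy=S(x+y)$; (Q6) $x\cdot0=0$; (Q7) $x\cdot Sy=x\cdot y+x$; (Q8) $x\leqslant y\leftrightarrow\exists r\,(r+x=y)$; (P1) $x^0=S(0)$; (P2) $y^{S(x)}=y^x\cdot y$; and the induction scheme $\big(\varphi(0,\bar y)\wedge\forall x(\varphi(x,\bar y)\to\varphi(S(x),\bar y))\big)\to\forall x\,\varphi(x,\bar y)$ for every quantifier-free formula $\varphi$ of this language. -}

module Defs where

open import Level using (0ℓ)
open import Data.Nat using (ℕ; zero; suc)
open import Data.Product using (Σ; _×_; _,_)
open import Data.Sum using (_⊎_)
open import Data.Empty using (⊥)
open import Data.Unit using (⊤)
open import Data.List using (List)
open import Data.List.Relation.Unary.Any using (Any)
open import Relation.Nullary using (¬_)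
open import Relation.Binary.Core using (Rel)
open import Relation.Binary.Structures using (IsTotalOrder)
open import Relation.Binary.PropositionalEquality using (_≡_; _≢_)
open import Algebra.Structures using (IsCommutativeRing)

record OrderedField : Set₁ where
  infixl 6 _+_
  infixl 7 _*_
  infix 4 _≤_ _<_
  field
    Carrier : Set
    _+_ _*_ : Carrier → Carrier → Carrier
    -_      : Carrier → Carrier
    0# 1#   : Carrier
    _≤_     : Rel Carrier 0ℓ
    isCommutativeRing : IsCommutativeRing _≡_ _+_ _*_ -_ 0# 1#
    0≢1     : 0# ≢ 1#
    inverse : ∀ x → x ≢ 0# → Σ Carrier (λ y → x * y ≡ 1#)
    isTotalOrder : IsTotalOrder _≡_ _≤_
    +-mono-≤ : ∀ {x y} z → x ≤ y → x + z ≤ y + z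
    *-nonneg : ∀ {x y} → 0# ≤ x → 0# ≤ y → 0# ≤ x * y

  _<_ : Rel Carrier 0ℓ
  x < y = x ≤ y × x ≢ y

record ExpField : Set₁ where
  field
    orderedField : OrderedField
  open OrderedField orderedField public
  field
    exp      : Carrier → Carrier
    log      : Carrier → Carrier
    exp-pos  : ∀ x → 0# < exp x
    exp-+    : ∀ x y → exp (x + y) ≡ exp x * exp y
    exp-<    : ∀ {x y} → x < y → exp x < exp y
    exp-log  : ∀ y → 0# < y → exp (log y) ≡ y

-- Environments (de Bruijn): variable 0 is the most recently bound one.

_∷ᵉ_ : {A : Set} → A → (ℕ → A) → (ℕ → A)
(a ∷ᵉ ρ) zero    = a
(a ∷ᵉ ρ) (suc i) = ρ i

data ETerm : Set where
  var      : ℕ → ETerm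
  zeroᵗ    : ETerm
  oneᵗ     : ETerm
  _+ᵗ_     : ETerm → ETerm → ETerm
  _*ᵗ_     : ETerm → ETerm → ETerm
  expᵗ     : ETerm → ETerm

data EFormula : Set where
  _≐_  : ETerm → ETerm → EFormula
  _≼_  : ETerm → ETerm → EFormula
  ⊥ᶠ   : EFormula
  ¬ᶠ_  : EFormula → EFormula
  _∧ᶠ_ : EFormula → EFormula → EFormula
  _∨ᶠ_ : EFormula → EFormula → EFormula
  _⇒ᶠ_ : EFormula → EFormula → EFormula
  ∃ᶠ   : EFormula → EFormula
  ∀ᶠ   : EFormula → EFormula

module ExpSemantics (F : ExpField) where
  open ExpField F

  evalE : ETerm → (ℕ → Carrier) → Carrier
  evalE (var i)   ρ = ρ i
  evalE zeroᵗ     ρ = 0#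
  evalE oneᵗ      ρ = 1#
  evalE (s +ᵗ t)  ρ = evalE s ρ + evalE t ρ
  evalE (s *ᵗ t)  ρ = evalE s ρ * evalE t ρ
  evalE (expᵗ t)  ρ = exp (evalE t ρ)

  SatE : EFormula → (ℕ → Carrier) → Set
  SatE (s ≐ t)   ρ = evalE s ρ ≡ evalE t ρ
  SatE (s ≼ t)   ρ = evalE s ρ ≤ evalE t ρ
  SatE ⊥ᶠ        ρ = ⊥
  SatE (¬ᶠ φ)    ρ = ¬ SatE φ ρ
  SatE (φ ∧ᶠ ψ)  ρ = SatE φ ρ × SatE ψ ρ
  SatE (φ ∨ᶠ ψ)  ρ = SatE φ ρ ⊎ SatE ψ ρ
  SatE (φ ⇒ᶠ ψ)  ρ = SatE φ ρ → SatE ψ ρ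
  SatE (∃ᶠ φ)    ρ = Σ Carrier (λ a → SatE φ (a ∷ᵉ ρ))
  SatE (∀ᶠ φ)    ρ = (a : Carrier) → SatE φ (a ∷ᵉ ρ)

module _ (F : ExpField) where
  open ExpField F

  data Ext : Set where
    -∞ +∞ : Ext
    fin   : Carrier → Ext

  data Piece : Set where
    point    : Carrier → Piece
    interval : Ext → Ext → Piece

  below : Ext → Carrier → Set
  below -∞      x = ⊤
  below +∞      x = ⊥
  below (fin a) x = a < x

  above : Ext → Carrier → Set
  above -∞      x = ⊥
  above +∞      x = ⊤
  above (fin b) x = x < b

  InPiece : Carrier → Piece → Set
  InPiece x (point a)      = x ≡ a
  InPiece x (interval l u) = below l x × above u x

open ExpSemantics public

OMinimal : ExpField → Set
OMinimal F =
  (φ : EFormula) (ρ : ℕ → Carrier) →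
  Σ (List (Piece F)) λ ps →
    (∀ a → SatE F φ (a ∷ᵉ ρ) → Any (InPiece F a) ps) ×
    (∀ a → Any (InPiece F a) ps → SatE F φ (a ∷ᵉ ρ))
  where open ExpField F

-- The function x^y is given
-- as a binary operation on the carrier that maps M⁺ × M⁺ into M⁺; only
-- its values on M⁺ × M⁺ are ever used.

module IntegerParts (F : ExpField) where
  open ExpField F

  M⁺ : (Carrier → Set) → Carrier → Set
  M⁺ M x = M x × 0# ≤ x

  S : Carrier → Carrier
  S x = x + 1#

  record IsDiscretelyOrderedSubring (M : Carrier → Set) : Set where
    field
      0∈ : M 0#
      1∈ : M 1#
      +∈ : ∀ {x y} → M x → M y → M (x + y)
      *∈ : ∀ {x y} → M x → M y → M (x * y)
      -∈ : ∀ {x} → M x → M (- x)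
      discrete : ∀ m → M m → 0# < m → 1# ≤ m

  record IsIntegerPart (M : Carrier → Set) : Set where
    field
      isDiscretelyOrderedSubring : IsDiscretelyOrderedSubring M
      intPart : ∀ r → Σ Carrier λ m → M m × m ≤ r × r < m + 1#

  record IsXYIntegerPart (M : Carrier → Set)
                         (pw : Carrier → Carrier → Carrier) : Set where
    field
      isIntegerPart : IsIntegerPart M
      pw-M⁺ : ∀ n m → M⁺ M n → M⁺ M m → M⁺ M (pw n m)
      pw-exp : ∀ n m → M⁺ M n → M⁺ M m → 0# < n → pw n m ≡ exp (m * log n)
      pw-00  : pw 0# 0# ≡ 1#
      pw-0m  : ∀ m → M m → 0# < m → pw 0# m ≡ 0#

  data ATerm : Set where
    var  : ℕ → ATerm
    zeroᵃ : ATerm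
    Sᵃ   : ATerm → ATerm
    _+ᵃ_ : ATerm → ATerm → ATerm
    _*ᵃ_ : ATerm → ATerm → ATerm
    _^ᵃ_ : ATerm → ATerm → ATerm

  data QF : Set where
    _≐_  : ATerm → ATerm → QF
    _≼_  : ATerm → ATerm → QF
    ⊥ᶠ   : QF
    ¬ᶠ_  : QF → QF
    _∧ᶠ_ : QF → QF → QF
    _∨ᶠ_ : QF → QF → QF
    _⇒ᶠ_ : QF → QF → QF

  module _ (pw : Carrier → Carrier → Carrier) where
    evalA : ATerm → (ℕ → Carrier) → Carrier
    evalA (var i)  ρ = ρ i
    evalA zeroᵃ    ρ = 0#
    evalA (Sᵃ t)   ρ = S (evalA t ρ)
    evalA (s +ᵃ t) ρ = evalA s ρ + evalA t ρ
    evalA (s *ᵃ t) ρ = evalA s ρ * evalA t ρ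
    evalA (s ^ᵃ t) ρ = pw (evalA s ρ) (evalA t ρ)

    SatA : QF → (ℕ → Carrier) → Set
    SatA (s ≐ t)  ρ = evalA s ρ ≡ evalA t ρ
    SatA (s ≼ t)  ρ = evalA s ρ ≤ evalA t ρ
    SatA ⊥ᶠ       ρ = ⊥
    SatA (¬ᶠ φ)   ρ = ¬ SatA φ ρ
    SatA (φ ∧ᶠ ψ) ρ = SatA φ ρ × SatA ψ ρ
    SatA (φ ∨ᶠ ψ) ρ = SatA φ ρ ⊎ SatA ψ ρ
    SatA (φ ⇒ᶠ ψ) ρ = SatA φ ρ → SatA ψ ρ

  record ModelsIOpen (M : Carrier → Set)
                     (pw : Carrier → Carrier → Carrier) : Set where
    field
      Q1 : ∀ x → M⁺ M x → S x ≢ 0#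
      Q2 : ∀ x y → M⁺ M x → M⁺ M y → S x ≡ S y → x ≡ y
      Q3 : ∀ x → M⁺ M x → x ≢ 0# → Σ Carrier λ y → M⁺ M y × x ≡ S y
      Q4 : ∀ x → M⁺ M x → x + 0# ≡ x
      Q5 : ∀ x y → M⁺ M x → M⁺ M y → x + S y ≡ S (x + y)
      Q6 : ∀ x → M⁺ M x → x * 0# ≡ 0#
      Q7 : ∀ x y → M⁺ M x → M⁺ M y → x * S y ≡ x * y + x
      Q8→ : ∀ x y → M⁺ M x → M⁺ M y →
              x ≤ y → Σ Carrier λ r → M⁺ M r × r + x ≡ y
      Q8← : ∀ x y → M⁺ M x → M⁺ M y →
              Σ Carrier (λ r → M⁺ M r × r + x ≡ y) → x ≤ y
      P1 : ∀ x → M⁺ M x → pw x 0# ≡ S 0#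
      P2 : ∀ x y → M⁺ M x → M⁺ M y → pw y (S x) ≡ pw y x * y
      IndOpen : (φ : QF) (ρ : ℕ → Carrier) → (∀ i → M⁺ M (ρ i)) →
                SatA pw φ (0# ∷ᵉ ρ) →
                (∀ x → M⁺ M x → SatA pw φ (x ∷ᵉ ρ) → SatA pw φ (S x ∷ᵉ ρ)) →
                ∀ x → M⁺ M x → SatA pw φ (x ∷ᵉ ρ)

open IntegerParts public using (M⁺; S; IsXYIntegerPart; ModelsIOpen)

{-# OPTIONS --safe #-}

-- The axioms other than induction are ring identities and facts about the discrete order of M,
-- and the recursion laws P1, P2 follow from y^x = exp (x · log y).  For open induction, an open
-- formula of (0,S,+,·,≤,x^y) is rewritten as a formula of (+,·,0,1,≤,exp) with the same meaning
-- on M⁺, so the counterexamples in M⁺ form a definable set: by o-minimality a finite union of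
-- points and intervals, in each of which the integer part M provides a least element of M⁺.
-- A least counterexample c is not 0, and c - 1 ∈ M⁺ is no counterexample, so the induction
-- step applied to c - 1 refutes c.

module Submission where

open import Defs hiding (M⁺; S)
open import Level using (0ℓ)
open import Axiom.ExcludedMiddle using (ExcludedMiddle)
open import Algebra.Bundles using (CommutativeRing)
import Algebra.Properties.Ring as RingProperties
open import Data.Nat as ℕ using (ℕ; zero; suc)
open import Data.Product using (Σ; _×_; _,_; proj₁; proj₂; map₂)
open import Data.Product.Function.NonDependent.Propositional using (_×-⇔_)
open import Data.Sum using (_⊎_; inj₁; inj₂)
open import Data.Sum.Function.Propositional using (_⊎-⇔_)
open import Data.Empty using (⊥-elim)
open import Data.Unit using (tt)
open import Data.List using ([]; _∷_)
open import Data.List.Relation.Unary.Any using (Any; here; there)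
open import Function.Base using (_∘′_)
open import Function.Bundles using (_⇔_; mk⇔; Equivalence)
open import Function.Related.TypeIsomorphisms using (→-cong-⇔; ¬-cong-⇔)
import Function.Properties.Equivalence as ⇔
open import Relation.Nullary using (¬_; yes; no)
open import Relation.Binary.PropositionalEquality
import Relation.Binary.Construct.NonStrictToStrict as NonStrictToStrict
open import Relation.Binary.Structures using (IsTotalOrder)

module OrderedFieldProperties (F : OrderedField) where
  open OrderedField F

  commutativeRing : CommutativeRing 0ℓ 0ℓ
  commutativeRing = record { isCommutativeRing = isCommutativeRing }

  open CommutativeRing commutativeRing public
    using (_-_; +-comm; +-assoc; +-identityˡ; +-identityʳ; -‿inverseʳ;
           *-identityˡ; *-identityʳ; distribˡ; distribʳ; zeroˡ; zeroʳ)
  open RingProperties (CommutativeRing.ring commutativeRing) public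
    using (+-cancelˡ; +-cancelʳ; //-rightDividesˡ; -‿involutive; -‿distribˡ-*)
  open IsTotalOrder isTotalOrder public
    using (total; antisym)
    renaming (refl to ≤-refl; trans to ≤-trans; reflexive to ≤-reflexive)

  ≤-<-trans : ∀ {x y z} → x ≤ y → y < z → x < z
  ≤-<-trans = NonStrictToStrict.≤-<-trans _≡_ _≤_ ≤-trans antisym (respˡ _≤_)

  <-≤-trans : ∀ {x y z} → x < y → y ≤ z → x < z
  <-≤-trans = NonStrictToStrict.<-≤-trans _≡_ _≤_ sym ≤-trans antisym (respʳ _≤_)

  <⇒≱ : ∀ {x y} → x < y → ¬ (y ≤ x)
  <⇒≱ = NonStrictToStrict.<⇒≱ _≡_ _≤_ antisym

  ≤⇒≡⊎< : ExcludedMiddle 0ℓ → ∀ {x y} → x ≤ y → x ≡ y ⊎ x < y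
  ≤⇒≡⊎< em {x} {y} x≤y with em {x ≡ y}
  ... | yes x≡y = inj₁ x≡y
  ... | no x≢y  = inj₂ (x≤y , x≢y)

  x≤y⇒0≤y-x : ∀ {x y} → x ≤ y → 0# ≤ y - x
  x≤y⇒0≤y-x {x} {y} x≤y = subst (_≤ y - x) (-‿inverseʳ x) (+-mono-≤ (- x) x≤y)

  x≤y+x : ∀ {x y} → 0# ≤ y → x ≤ y + x
  x≤y+x {x} {y} 0≤y = subst (_≤ y + x) (+-identityˡ x) (+-mono-≤ x 0≤y)

  +-nonneg : ∀ {x y} → 0# ≤ x → 0# ≤ y → 0# ≤ x + y
  +-nonneg {x} {y} 0≤x 0≤y = ≤-trans 0≤x (subst (x ≤_) (+-comm y x) (x≤y+x 0≤y))

  0≤1 : 0# ≤ 1#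
  0≤1 with total 0# 1#
  ... | inj₁ 0≤1 = 0≤1
  ... | inj₂ 1≤0 = subst (0# ≤_) -1*-1≡1 (*-nonneg 0≤-1 0≤-1)
    where
    0≤-1 : 0# ≤ - 1#
    0≤-1 = subst₂ _≤_ (-‿inverseʳ 1#) (+-identityˡ (- 1#)) (+-mono-≤ (- 1#) 1≤0)
    -1*-1≡1 : - 1# * - 1# ≡ 1#
    -1*-1≡1 = trans (sym (-‿distribˡ-* 1# (- 1#)))
                    (trans (cong -_ (*-identityˡ (- 1#))) (-‿involutive 1#))

  0<1 : 0# < 1#
  0<1 = 0≤1 , 0≢1

  x<x+1 : ∀ x → x < x + 1#
  x<x+1 x = subst (x ≤_) (+-comm 1# x) (x≤y+x 0≤1)
          , λ x≡x+1 → 0≢1 (+-cancelˡ x 0# 1# (trans (+-identityʳ x) x≡x+1))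

  x-1<x : ∀ x → x - 1# < x
  x-1<x x = subst (x - 1# <_) (//-rightDividesˡ 1# x) (x<x+1 (x - 1#))

module ExpFieldProperties (F : ExpField) where
  open ExpField F
  open OrderedFieldProperties orderedField
  open ≡-Reasoning

  exp-0 : exp 0# ≡ 1#
  exp-0 = begin
    exp 0#                 ≡⟨ *-identityʳ (exp 0#) ⟨
    exp 0# * 1#            ≡⟨ cong (exp 0# *_) (exp-log 1# 0<1) ⟨
    exp 0# * exp (log 1#)  ≡⟨ exp-+ 0# (log 1#) ⟨
    exp (0# + log 1#)      ≡⟨ cong exp (+-identityˡ (log 1#)) ⟩
    exp (log 1#)           ≡⟨ exp-log 1# 0<1 ⟩
    1#                     ∎

  exp-injective : ExcludedMiddle 0ℓ → ∀ {x y} → exp x ≡ exp y → x ≡ y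
  exp-injective em {x} {y} ex≡ey with total x y
  ... | inj₁ x≤y with ≤⇒≡⊎< em x≤y
  ...   | inj₁ x≡y = x≡y
  ...   | inj₂ x<y = ⊥-elim (proj₂ (exp-< x<y) ex≡ey)
  exp-injective em {x} {y} ex≡ey | inj₂ y≤x with ≤⇒≡⊎< em y≤x
  ...   | inj₁ y≡x = sym y≡x
  ...   | inj₂ y<x = ⊥-elim (proj₂ (exp-< y<x) (sym ex≡ey))

module IntegerPartProperties (F : ExpField) {M : ExpField.Carrier F → Set}
  (isIntegerPart : IntegerParts.IsIntegerPart F M) where
  open ExpField F
  open OrderedFieldProperties orderedField
  open IntegerParts F using (M⁺; S; IsIntegerPart; IsDiscretelyOrderedSubring)
  open IsIntegerPart isIntegerPart
  open IsDiscretelyOrderedSubring isDiscretelyOrderedSubring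

  0∈M⁺ : M⁺ M 0#
  0∈M⁺ = 0∈ , ≤-refl

  +∈M⁺ : ∀ {x y} → M⁺ M x → M⁺ M y → M⁺ M (x + y)
  +∈M⁺ (x∈M , 0≤x) (y∈M , 0≤y) = +∈ x∈M y∈M , +-nonneg 0≤x 0≤y

  *∈M⁺ : ∀ {x y} → M⁺ M x → M⁺ M y → M⁺ M (x * y)
  *∈M⁺ (x∈M , 0≤x) (y∈M , 0≤y) = *∈ x∈M y∈M , *-nonneg 0≤x 0≤y

  S∈M⁺ : ∀ {x} → M⁺ M x → M⁺ M (S x)
  S∈M⁺ x∈M⁺ = +∈M⁺ x∈M⁺ (1∈ , 0≤1)

  -∈M⁺ : ∀ {x y} → M x → M⁺ M y → x ≤ y → M⁺ M (y - x)
  -∈M⁺ x∈M (y∈M , _) x≤y = +∈ y∈M (-∈ x∈M) , x≤y⇒0≤y-x x≤y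

  pred∈M⁺ : ∀ {x} → M⁺ M x → 0# < x → M⁺ M (x - 1#)
  pred∈M⁺ x∈M⁺ 0<x = -∈M⁺ 1∈ x∈M⁺ (discrete _ (proj₁ x∈M⁺) 0<x)

  M⁺-predecessor : ∀ {x} → M⁺ M x → x ≢ 0# → Σ Carrier λ y → M⁺ M y × x ≡ S y
  M⁺-predecessor {x} x∈M⁺ x≢0 =
    x - 1# , pred∈M⁺ x∈M⁺ (proj₂ x∈M⁺ , x≢0 ∘′ sym) , sym (//-rightDividesˡ 1# x)

  M⁺-difference : ∀ {x y} → M⁺ M x → M⁺ M y → x ≤ y → Σ Carrier λ r → M⁺ M r × r + x ≡ y
  M⁺-difference {x} {y} x∈M⁺ y∈M⁺ x≤y =
    y - x , -∈M⁺ (proj₁ x∈M⁺) y∈M⁺ x≤y , //-rightDividesˡ x y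

  AllM⁺ : (ℕ → Carrier) → Set
  AllM⁺ ρ = ∀ i → M⁺ M (ρ i)

  ∷ᵉ-M⁺ : ∀ {a ρ} → M⁺ M a → AllM⁺ ρ → AllM⁺ (a ∷ᵉ ρ)
  ∷ᵉ-M⁺ a∈M⁺ ρ∈M⁺ zero    = a∈M⁺
  ∷ᵉ-M⁺ a∈M⁺ ρ∈M⁺ (suc i) = ρ∈M⁺ i

  S≢0 : ∀ {x} → M⁺ M x → S x ≢ 0#
  S≢0 {x} (_ , 0≤x) Sx≡0 = proj₂ (≤-<-trans 0≤x (x<x+1 x)) (sym Sx≡0)

  <⇒S≤ : ∀ {k m} → M k → M m → k < m → S k ≤ m
  <⇒S≤ {k} {m} k∈M m∈M (k≤m , k≢m) =
    subst₂ _≤_ (+-comm 1# k) (//-rightDividesˡ k m) (+-mono-≤ k 1≤m-k)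
    where
    m-k≢0 : m - k ≢ 0#
    m-k≢0 m-k≡0 =
      k≢m (sym (+-cancelʳ (- k) m k (trans m-k≡0 (sym (-‿inverseʳ k)))))
    1≤m-k : 1# ≤ m - k
    1≤m-k = discrete (m - k) (+∈ m∈M (-∈ k∈M)) (x≤y⇒0≤y-x k≤m , m-k≢0 ∘′ sym)

  IsLeast : (Carrier → Set) → Carrier → Set
  IsLeast A c = A c × (∀ n → A n → c ≤ n)

  HasLeast : (Carrier → Set) → Set
  HasLeast A = Σ Carrier A → Σ Carrier (IsLeast A)

  hasLeast-resp : ∀ {A B : Carrier → Set} → (∀ n → A n ⇔ B n) → HasLeast A → HasLeast B
  hasLeast-resp A⇔B hasLeast (m , Bm) with hasLeast (m , Equivalence.from (A⇔B m) Bm)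
  ... | c , Ac , c≤A =
    c , Equivalence.to (A⇔B c) Ac , λ n Bn → c≤A n (Equivalence.from (A⇔B n) Bn)

  isLeast-⊎ : ∀ {A B : Carrier → Set} {a b} → IsLeast A a → IsLeast B b →
              Σ Carrier (IsLeast (λ n → A n ⊎ B n))
  isLeast-⊎ {a = a} {b} (Aa , a≤A) (Bb , b≤B) with total a b
  ... | inj₁ a≤b = a , inj₁ Aa ,
    λ { n (inj₁ An) → a≤A n An ; n (inj₂ Bn) → ≤-trans a≤b (b≤B n Bn) }
  ... | inj₂ b≤a = b , inj₂ Bb ,
    λ { n (inj₁ An) → ≤-trans b≤a (a≤A n An) ; n (inj₂ Bn) → b≤B n Bn }

  isLeast-⊎ˡ : ∀ {A B : Carrier → Set} {a} → IsLeast A a → ¬ Σ Carrier B →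
               IsLeast (λ n → A n ⊎ B n) a
  isLeast-⊎ˡ (Aa , a≤A) ∄B =
    inj₁ Aa , λ { n (inj₁ An) → a≤A n An ; n (inj₂ Bn) → ⊥-elim (∄B (n , Bn)) }

  isLeast-⊎ʳ : ∀ {A B : Carrier → Set} {b} → ¬ Σ Carrier A → IsLeast B b →
               IsLeast (λ n → A n ⊎ B n) b
  isLeast-⊎ʳ ∄A (Bb , b≤B) =
    inj₂ Bb , λ { n (inj₁ An) → ⊥-elim (∄A (n , An)) ; n (inj₂ Bn) → b≤B n Bn }

  hasLeast-⊎ : ExcludedMiddle 0ℓ → ∀ {A B : Carrier → Set} →
               HasLeast A → HasLeast B → HasLeast (λ n → A n ⊎ B n)
  hasLeast-⊎ em {B = B} hasLeastA hasLeastB (m , inj₁ Am)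
    with hasLeastA (m , Am) | em {Σ Carrier B}
  ... | a , least-a | yes ∃B = isLeast-⊎ least-a (proj₂ (hasLeastB ∃B))
  ... | a , least-a | no ∄B  = a , isLeast-⊎ˡ least-a ∄B
  hasLeast-⊎ em {A = A} hasLeastA hasLeastB (m , inj₂ Bm)
    with hasLeastB (m , Bm) | em {Σ Carrier A}
  ... | b , least-b | yes ∃A = isLeast-⊎ (proj₂ (hasLeastA ∃A)) least-b
  ... | b , least-b | no ∄A  = b , isLeast-⊎ʳ ∄A least-b

  leastAbove : ∀ a → Σ Carrier λ c → M⁺ M c × a < c × (∀ n → M⁺ M n → a < n → c ≤ n)
  leastAbove a with intPart a
  ... | k , k∈M , k≤a , a<k+1 with total (k + 1#) 0#
  ...   | inj₁ k+1≤0 = 0# , 0∈M⁺ , <-≤-trans a<k+1 k+1≤0 , λ n n∈M⁺ _ → proj₂ n∈M⁺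
  ...   | inj₂ 0≤k+1 = k + 1# , (+∈ k∈M 1∈ , 0≤k+1) , a<k+1 ,
                       λ n n∈M⁺ a<n → <⇒S≤ k∈M (proj₁ n∈M⁺) (≤-<-trans k≤a a<n)

  above-antitone : ∀ u {x y} → x ≤ y → above F u y → above F u x
  above-antitone +∞      x≤y tt  = tt
  above-antitone (fin b) x≤y y<b = ≤-<-trans x≤y y<b

  M⁺∩interval-hasLeast : ∀ l u {c} → M⁺ M c → below F l c →
                         (∀ n → M⁺ M n → below F l n → c ≤ n) →
                         HasLeast (λ n → M⁺ M n × InPiece F n (interval l u))
  M⁺∩interval-hasLeast l u c∈M⁺ l<c c≤ (m , m∈M⁺ , l<m , m<u) =
    _ , (c∈M⁺ , l<c , above-antitone u (c≤ m m∈M⁺ l<m) m<u) ,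
    λ n (n∈M⁺ , l<n , _) → c≤ n n∈M⁺ l<n

  M⁺∩piece-hasLeast : ∀ p → HasLeast (λ n → M⁺ M n × InPiece F n p)
  M⁺∩piece-hasLeast (point a) (m , m∈M⁺ , m≡a) =
    m , (m∈M⁺ , m≡a) , λ n (_ , n≡a) → ≤-reflexive (trans m≡a (sym n≡a))
  M⁺∩piece-hasLeast (interval -∞ u) =
    M⁺∩interval-hasLeast -∞ u 0∈M⁺ tt (λ n n∈M⁺ _ → proj₂ n∈M⁺)
  M⁺∩piece-hasLeast (interval +∞ u) (_ , _ , () , _)
  M⁺∩piece-hasLeast (interval (fin a) u) with leastAbove a
  ... | c , c∈M⁺ , a<c , c≤ = M⁺∩interval-hasLeast (fin a) u c∈M⁺ a<c c≤

  M⁺∩pieces-hasLeast : ExcludedMiddle 0ℓ →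
                       ∀ ps → HasLeast (λ n → M⁺ M n × Any (InPiece F n) ps)
  M⁺∩pieces-hasLeast em []       (_ , _ , ())
  M⁺∩pieces-hasLeast em (p ∷ ps) =
    hasLeast-resp (λ n → mk⇔ to from)
      (hasLeast-⊎ em (M⁺∩piece-hasLeast p) (M⁺∩pieces-hasLeast em ps))
    where
    Split Joined : Carrier → Set
    Split n = (M⁺ M n × InPiece F n p) ⊎ (M⁺ M n × Any (InPiece F n) ps)
    Joined n = M⁺ M n × Any (InPiece F n) (p ∷ ps)
    to : ∀ {n} → Split n → Joined n
    to = λ { (inj₁ (n∈M⁺ , inP))  → n∈M⁺ , here inP
           ; (inj₂ (n∈M⁺ , inPs)) → n∈M⁺ , there inPs }
    from : ∀ {n} → Joined n → Split n
    from = λ { (n∈M⁺ , here inP)   → inj₁ (n∈M⁺ , inP)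
             ; (n∈M⁺ , there inPs) → inj₂ (n∈M⁺ , inPs) }

  M⁺∩definable-hasLeast : ExcludedMiddle 0ℓ → OMinimal F →
                          ∀ φ ρ → HasLeast (λ n → M⁺ M n × SatE F φ (n ∷ᵉ ρ))
  M⁺∩definable-hasLeast em omin φ ρ with omin φ ρ
  ... | ps , sat⇒any , any⇒sat =
    hasLeast-resp (λ n → mk⇔ (map₂ (any⇒sat n)) (map₂ (sat⇒any n)))
      (M⁺∩pieces-hasLeast em ps)

  M⁺-induction : ExcludedMiddle 0ℓ → (P : Carrier → Set) →
                 HasLeast (λ n → M⁺ M n × ¬ P n) →
                 P 0# → (∀ x → M⁺ M x → P x → P (S x)) → ∀ x → M⁺ M x → P x
  M⁺-induction em P hasLeast P0 PS x x∈M⁺ with em {P x}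
  ... | yes Px = Px
  ... | no ¬Px = ⊥-elim (noLeastCounterexample (hasLeast (x , x∈M⁺ , ¬Px)))
    where
    noLeastCounterexample : ¬ Σ Carrier (IsLeast (λ n → M⁺ M n × ¬ P n))
    noLeastCounterexample (c , (c∈M⁺ , ¬Pc) , c≤) with ≤⇒≡⊎< em (proj₂ c∈M⁺)
    ... | inj₁ 0≡c = ¬Pc (subst P 0≡c P0)
    ... | inj₂ 0<c with em {P (c - 1#)}
    ...   | yes Pc-1 =
      ¬Pc (subst P (//-rightDividesˡ 1# c) (PS (c - 1#) (pred∈M⁺ c∈M⁺ 0<c) Pc-1))
    ...   | no ¬Pc-1 = <⇒≱ (x-1<x c) (c≤ (c - 1#) (pred∈M⁺ c∈M⁺ 0<c , ¬Pc-1))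

module XYIntegerPartProperties (em : ExcludedMiddle 0ℓ) (F : ExpField)
  {M : ExpField.Carrier F → Set}
  {pw : ExpField.Carrier F → ExpField.Carrier F → ExpField.Carrier F}
  (xy : IntegerParts.IsXYIntegerPart F M pw) where
  open ExpField F
  open OrderedFieldProperties orderedField
  open ExpFieldProperties F
  open IntegerParts F hiding (IsXYIntegerPart; ModelsIOpen)
  open IsXYIntegerPart xy
  open IntegerPartProperties F isIntegerPart
  open ≡-Reasoning

  pw-at-00 : ∀ {x y} → 0# ≡ x → 0# ≡ y → pw x y ≡ 1#
  pw-at-00 refl refl = pw-00

  pw-at-0m : ∀ {x y} → 0# ≡ x → M y → 0# < y → pw x y ≡ 0#
  pw-at-0m refl y∈M 0<y = pw-0m _ y∈M 0<y

  pw-zeroʳ : ∀ x → M⁺ M x → pw x 0# ≡ S 0#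
  pw-zeroʳ x x∈M⁺ with ≤⇒≡⊎< em (proj₂ x∈M⁺)
  ... | inj₁ refl = trans pw-00 (sym (+-identityˡ 1#))
  ... | inj₂ 0<x  = begin
    pw x 0#            ≡⟨ pw-exp x 0# x∈M⁺ 0∈M⁺ 0<x ⟩
    exp (0# * log x)   ≡⟨ cong exp (zeroˡ (log x)) ⟩
    exp 0#             ≡⟨ exp-0 ⟩
    1#                 ≡⟨ +-identityˡ 1# ⟨
    S 0#               ∎

  pw-sucʳ : ∀ x y → M⁺ M x → M⁺ M y → pw y (S x) ≡ pw y x * y
  pw-sucʳ x y x∈M⁺ y∈M⁺ with ≤⇒≡⊎< em (proj₂ y∈M⁺)
  ... | inj₁ refl = trans (pw-0m (S x) (proj₁ (S∈M⁺ x∈M⁺)) 0<Sx) (sym (zeroʳ (pw 0# x)))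
    where 0<Sx = ≤-<-trans (proj₂ x∈M⁺) (x<x+1 x)
  ... | inj₂ 0<y  = begin
    pw y (x + 1#)                       ≡⟨ pw-exp y (x + 1#) y∈M⁺ (S∈M⁺ x∈M⁺) 0<y ⟩
    exp ((x + 1#) * log y)              ≡⟨ cong exp (distribʳ (log y) x 1#) ⟩
    exp (x * log y + 1# * log y)        ≡⟨ exp-+ (x * log y) (1# * log y) ⟩
    exp (x * log y) * exp (1# * log y)  ≡⟨ cong (λ a → exp (x * log y) * exp a) (*-identityˡ (log y)) ⟩
    exp (x * log y) * exp (log y)       ≡⟨ cong (exp (x * log y) *_) (exp-log y 0<y) ⟩
    exp (x * log y) * y                 ≡⟨ cong (_* y) (pw-exp y x y∈M⁺ x∈M⁺ 0<y) ⟨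
    pw y x * y                          ∎

  evalA-M⁺ : ∀ t ρ → AllM⁺ ρ → M⁺ M (evalA pw t ρ)
  evalA-M⁺ (var i)  ρ ρ∈M⁺ = ρ∈M⁺ i
  evalA-M⁺ zeroᵃ    ρ ρ∈M⁺ = 0∈M⁺
  evalA-M⁺ (Sᵃ t)   ρ ρ∈M⁺ = S∈M⁺ (evalA-M⁺ t ρ ρ∈M⁺)
  evalA-M⁺ (s +ᵃ t) ρ ρ∈M⁺ = +∈M⁺ (evalA-M⁺ s ρ ρ∈M⁺) (evalA-M⁺ t ρ ρ∈M⁺)
  evalA-M⁺ (s *ᵃ t) ρ ρ∈M⁺ = *∈M⁺ (evalA-M⁺ s ρ ρ∈M⁺) (evalA-M⁺ t ρ ρ∈M⁺)
  evalA-M⁺ (s ^ᵃ t) ρ ρ∈M⁺ = pw-M⁺ _ _ (evalA-M⁺ s ρ ρ∈M⁺) (evalA-M⁺ t ρ ρ∈M⁺)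

  _≺_ : ETerm → ETerm → EFormula
  s ≺ t = (s ≼ t) ∧ᶠ (¬ᶠ (s ≐ t))

  -- log is not in the language, so u ^ v is written exp (v · w) for the w with exp w = u.
  powGraph : ℕ → ℕ → ℕ → EFormula
  powGraph u v z =
    ((zeroᵗ ≺ var u) ∧ᶠ
       ∃ᶠ ((expᵗ (var 0) ≐ var (suc u)) ∧ᶠ (var (suc z) ≐ expᵗ (var (suc v) *ᵗ var 0))))
    ∨ᶠ ((((zeroᵗ ≐ var u) ∧ᶠ (zeroᵗ ≐ var v)) ∧ᶠ (var z ≐ oneᵗ))
    ∨ᶠ (((zeroᵗ ≐ var u) ∧ᶠ (zeroᵗ ≺ var v)) ∧ᶠ (var z ≐ zeroᵗ)))

  powGraph-sound : ∀ u v z τ → M⁺ M (τ u) → M⁺ M (τ v) →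
                   SatE F (powGraph u v z) τ → τ z ≡ pw (τ u) (τ v)
  powGraph-sound u v z τ u∈M⁺ v∈M⁺ (inj₁ (0<u , w , ew≡u , z≡exp[vw])) = begin
    τ z                    ≡⟨ z≡exp[vw] ⟩
    exp (τ v * w)          ≡⟨ cong (λ w′ → exp (τ v * w′)) w≡log[u] ⟩
    exp (τ v * log (τ u))  ≡⟨ pw-exp (τ u) (τ v) u∈M⁺ v∈M⁺ 0<u ⟨
    pw (τ u) (τ v)         ∎
    where w≡log[u] = exp-injective em (trans ew≡u (sym (exp-log (τ u) 0<u)))
  powGraph-sound u v z τ u∈M⁺ v∈M⁺ (inj₂ (inj₁ ((0≡u , 0≡v) , z≡1))) =
    trans z≡1 (sym (pw-at-00 0≡u 0≡v))
  powGraph-sound u v z τ u∈M⁺ v∈M⁺ (inj₂ (inj₂ ((0≡u , 0<v) , z≡0))) =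
    trans z≡0 (sym (pw-at-0m 0≡u (proj₁ v∈M⁺) 0<v))

  powGraph-complete : ∀ u v z τ → M⁺ M (τ u) → M⁺ M (τ v) →
                      τ z ≡ pw (τ u) (τ v) → SatE F (powGraph u v z) τ
  powGraph-complete u v z τ u∈M⁺ v∈M⁺ z≡u^v
    with ≤⇒≡⊎< em (proj₂ u∈M⁺) | ≤⇒≡⊎< em (proj₂ v∈M⁺)
  ... | inj₂ 0<u | _ =
    inj₁ (0<u , log (τ u) , exp-log (τ u) 0<u ,
          trans z≡u^v (pw-exp (τ u) (τ v) u∈M⁺ v∈M⁺ 0<u))
  ... | inj₁ 0≡u | inj₁ 0≡v =
    inj₂ (inj₁ ((0≡u , 0≡v) , trans z≡u^v (pw-at-00 0≡u 0≡v)))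
  ... | inj₁ 0≡u | inj₂ 0<v =
    inj₂ (inj₂ ((0≡u , 0<v) , trans z≡u^v (pw-at-0m 0≡u (proj₁ v∈M⁺) 0<v)))

  dropᵉ : ℕ → (ℕ → Carrier) → (ℕ → Carrier)
  dropᵉ d σ i = σ (d ℕ.+ i)

  withValues : ATerm → ATerm → ℕ → (ℕ → Carrier) → (ℕ → Carrier)
  withValues s t d σ = evalA pw t (dropᵉ d σ) ∷ᵉ (evalA pw s (dropᵉ d σ) ∷ᵉ σ)

  -- termGraph t d z says that variable z holds the value of t, whose variables are read d
  -- places further out; bothGraphs s t d ψ binds the values of s and t as variables 1, 0 of ψ.
  termGraph : ATerm → ℕ → ℕ → EFormula
  bothGraphs : ATerm → ATerm → ℕ → EFormula → EFormula

  termGraph (var i)  d z = var (d ℕ.+ i) ≐ var z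
  termGraph zeroᵃ    d z = zeroᵗ ≐ var z
  termGraph (Sᵃ t)   d z = ∃ᶠ (termGraph t (suc d) 0 ∧ᶠ (var (suc z) ≐ (var 0 +ᵗ oneᵗ)))
  termGraph (s +ᵃ t) d z = bothGraphs s t d (var (suc (suc z)) ≐ (var 1 +ᵗ var 0))
  termGraph (s *ᵃ t) d z = bothGraphs s t d (var (suc (suc z)) ≐ (var 1 *ᵗ var 0))
  termGraph (s ^ᵃ t) d z = bothGraphs s t d (powGraph 1 0 (suc (suc z)))

  bothGraphs s t d ψ =
    ∃ᶠ (∃ᶠ ((termGraph s (suc (suc d)) 1 ∧ᶠ termGraph t (suc (suc d)) 0) ∧ᶠ ψ))

  termGraph-sound : ∀ t d z σ → AllM⁺ (dropᵉ d σ) →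
                    SatE F (termGraph t d z) σ → σ z ≡ evalA pw t (dropᵉ d σ)
  bothGraphs-sound : ∀ s t d ψ σ → AllM⁺ (dropᵉ d σ) →
                     SatE F (bothGraphs s t d ψ) σ → SatE F ψ (withValues s t d σ)

  termGraph-sound (var i)  d z σ σ∈M⁺ i≡z = sym i≡z
  termGraph-sound zeroᵃ    d z σ σ∈M⁺ 0≡z = sym 0≡z
  termGraph-sound (Sᵃ t)   d z σ σ∈M⁺ (a , graph-t , z≡a+1) =
    trans z≡a+1 (cong S (termGraph-sound t (suc d) 0 (a ∷ᵉ σ) σ∈M⁺ graph-t))
  termGraph-sound (s +ᵃ t) d z =
    bothGraphs-sound s t d (var (suc (suc z)) ≐ (var 1 +ᵗ var 0))
  termGraph-sound (s *ᵃ t) d z =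
    bothGraphs-sound s t d (var (suc (suc z)) ≐ (var 1 *ᵗ var 0))
  termGraph-sound (s ^ᵃ t) d z σ σ∈M⁺ graphs =
    powGraph-sound 1 0 (suc (suc z)) (withValues s t d σ)
      (evalA-M⁺ s (dropᵉ d σ) σ∈M⁺) (evalA-M⁺ t (dropᵉ d σ) σ∈M⁺)
      (bothGraphs-sound s t d (powGraph 1 0 (suc (suc z))) σ σ∈M⁺ graphs)

  bothGraphs-sound s t d ψ σ σ∈M⁺ (a , b , (graph-s , graph-t) , ψ[a,b]) =
    subst₂ (λ a b → SatE F ψ (b ∷ᵉ (a ∷ᵉ σ)))
      (termGraph-sound s (suc (suc d)) 1 (b ∷ᵉ (a ∷ᵉ σ)) σ∈M⁺ graph-s)
      (termGraph-sound t (suc (suc d)) 0 (b ∷ᵉ (a ∷ᵉ σ)) σ∈M⁺ graph-t)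
      ψ[a,b]

  termGraph-complete : ∀ t d z σ → AllM⁺ (dropᵉ d σ) →
                       σ z ≡ evalA pw t (dropᵉ d σ) → SatE F (termGraph t d z) σ
  bothGraphs-complete : ∀ s t d ψ σ → AllM⁺ (dropᵉ d σ) →
                        SatE F ψ (withValues s t d σ) → SatE F (bothGraphs s t d ψ) σ

  termGraph-complete (var i)  d z σ σ∈M⁺ z≡i = sym z≡i
  termGraph-complete zeroᵃ    d z σ σ∈M⁺ z≡0 = sym z≡0
  termGraph-complete (Sᵃ t)   d z σ σ∈M⁺ z≡t+1 =
    evalA pw t (dropᵉ d σ) , termGraph-complete t (suc d) 0 _ σ∈M⁺ refl , z≡t+1
  termGraph-complete (s +ᵃ t) d z =
    bothGraphs-complete s t d (var (suc (suc z)) ≐ (var 1 +ᵗ var 0))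
  termGraph-complete (s *ᵃ t) d z =
    bothGraphs-complete s t d (var (suc (suc z)) ≐ (var 1 *ᵗ var 0))
  termGraph-complete (s ^ᵃ t) d z σ σ∈M⁺ z≡s^t =
    bothGraphs-complete s t d (powGraph 1 0 (suc (suc z))) σ σ∈M⁺
      (powGraph-complete 1 0 (suc (suc z)) (withValues s t d σ)
        (evalA-M⁺ s (dropᵉ d σ) σ∈M⁺) (evalA-M⁺ t (dropᵉ d σ) σ∈M⁺) z≡s^t)

  bothGraphs-complete s t d ψ σ σ∈M⁺ ψ[s,t] =
    evalA pw s (dropᵉ d σ) , evalA pw t (dropᵉ d σ) ,
    (termGraph-complete s (suc (suc d)) 1 _ σ∈M⁺ refl ,
     termGraph-complete t (suc (suc d)) 0 _ σ∈M⁺ refl) ,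
    ψ[s,t]

  bothGraphs-correct : ∀ s t ψ σ → AllM⁺ σ →
                       SatE F (bothGraphs s t 0 ψ) σ ⇔ SatE F ψ (withValues s t 0 σ)
  bothGraphs-correct s t ψ σ σ∈M⁺ =
    mk⇔ (bothGraphs-sound s t 0 ψ σ σ∈M⁺) (bothGraphs-complete s t 0 ψ σ σ∈M⁺)

  translate : QF → EFormula
  translate (s ≐ t)  = bothGraphs s t 0 (var 1 ≐ var 0)
  translate (s ≼ t)  = bothGraphs s t 0 (var 1 ≼ var 0)
  translate ⊥ᶠ       = ⊥ᶠ
  translate (¬ᶠ φ)   = ¬ᶠ translate φ
  translate (φ ∧ᶠ ψ) = translate φ ∧ᶠ translate ψ
  translate (φ ∨ᶠ ψ) = translate φ ∨ᶠ translate ψ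
  translate (φ ⇒ᶠ ψ) = translate φ ⇒ᶠ translate ψ

  translate-correct : ∀ φ σ → AllM⁺ σ → SatE F (translate φ) σ ⇔ SatA pw φ σ
  translate-correct (s ≐ t)  σ σ∈M⁺ = bothGraphs-correct s t (var 1 ≐ var 0) σ σ∈M⁺
  translate-correct (s ≼ t)  σ σ∈M⁺ = bothGraphs-correct s t (var 1 ≼ var 0) σ σ∈M⁺
  translate-correct ⊥ᶠ       σ σ∈M⁺ = ⇔.refl
  translate-correct (¬ᶠ φ)   σ σ∈M⁺ = ¬-cong-⇔ (translate-correct φ σ σ∈M⁺)
  translate-correct (φ ∧ᶠ ψ) σ σ∈M⁺ =
    translate-correct φ σ σ∈M⁺ ×-⇔ translate-correct ψ σ σ∈M⁺
  translate-correct (φ ∨ᶠ ψ) σ σ∈M⁺ =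
    translate-correct φ σ σ∈M⁺ ⊎-⇔ translate-correct ψ σ σ∈M⁺
  translate-correct (φ ⇒ᶠ ψ) σ σ∈M⁺ =
    →-cong-⇔ (translate-correct φ σ σ∈M⁺) (translate-correct ψ σ σ∈M⁺)

  open-induction : OMinimal F → (φ : QF) (ρ : ℕ → Carrier) → AllM⁺ ρ →
                   SatA pw φ (0# ∷ᵉ ρ) →
                   (∀ x → M⁺ M x → SatA pw φ (x ∷ᵉ ρ) → SatA pw φ (S x ∷ᵉ ρ)) →
                   ∀ x → M⁺ M x → SatA pw φ (x ∷ᵉ ρ)
  open-induction omin φ ρ ρ∈M⁺ =
    M⁺-induction em (λ x → SatA pw φ (x ∷ᵉ ρ))
      (hasLeast-resp (λ n → mk⇔ (to n) (from n))
        (M⁺∩definable-hasLeast em omin (¬ᶠ translate φ) ρ))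
    where
    correct : ∀ {n} → M⁺ M n → SatE F (translate φ) (n ∷ᵉ ρ) ⇔ SatA pw φ (n ∷ᵉ ρ)
    correct n∈M⁺ = translate-correct φ _ (∷ᵉ-M⁺ n∈M⁺ ρ∈M⁺)
    to : ∀ n → M⁺ M n × SatE F (¬ᶠ translate φ) (n ∷ᵉ ρ) →
               M⁺ M n × ¬ SatA pw φ (n ∷ᵉ ρ)
    to n (n∈M⁺ , ¬φ) = n∈M⁺ , ¬φ ∘′ Equivalence.from (correct n∈M⁺)
    from : ∀ n → M⁺ M n × ¬ SatA pw φ (n ∷ᵉ ρ) →
                 M⁺ M n × SatE F (¬ᶠ translate φ) (n ∷ᵉ ρ)
    from n (n∈M⁺ , ¬φ) = n∈M⁺ , ¬φ ∘′ Equivalence.to (correct n∈M⁺)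

theorem2p4 : ExcludedMiddle 0ℓ →
    (F : ExpField) → OMinimal F →
    (M : ExpField.Carrier F → Set) →
    (pw : ExpField.Carrier F → ExpField.Carrier F → ExpField.Carrier F) →
    IsXYIntegerPart F M pw →
    ModelsIOpen F M pw
theorem2p4 em F omin M pw xy = record
  { Q1      = λ x → S≢0
  ; Q2      = λ x y _ _ → +-cancelʳ 1# x y
  ; Q3      = λ x → M⁺-predecessor
  ; Q4      = λ x _ → +-identityʳ x
  ; Q5      = λ x y _ _ → sym (+-assoc x y 1#)
  ; Q6      = λ x _ → zeroʳ x
  ; Q7      = λ x y _ _ → trans (distribˡ x y 1#) (cong (x * y +_) (*-identityʳ x))
  ; Q8→     = λ x y → M⁺-difference
  ; Q8←     = λ { x y _ _ (r , r∈M⁺ , r+x≡y) → subst (x ≤_) r+x≡y (x≤y+x (proj₂ r∈M⁺)) }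
  ; P1      = pw-zeroʳ
  ; P2      = pw-sucʳ
  ; IndOpen = open-induction omin
  }
  where
  open ExpField F
  open OrderedFieldProperties orderedField
  open IsXYIntegerPart xy using (isIntegerPart)
  open IntegerPartProperties F isIntegerPart
  open XYIntegerPartProperties em F xy
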